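{- Let $1\le k\le \ell$ and $s\ge 1$ be integers. If $(\mathbf{m},\mathbf{n})\in\widetilde{\mathcal{D}}(k,\ell)$, then for any $\mathbf{p}\in\mathbb{N}_0^k$ and $\mathbf{q}\in\mathbb{N}_0^\ell$ with $|\mathbf{p}|=|\mathbf{q}|$, we have $(\mathbf{m}+\mathbf{p},\mathbf{n}+\mathbf{q})\in\widetilde{\mathcal{D}}(k,\ell)$.
   Context: $\mathbb{N}=\{1,2,\dots\}$, $\mathbb{N}_0=\mathbb{N}\cup\{0\}$; for a tuple $\mathbf{x}$, $|\mathbf{x}|$ is the sum of its entries. For $\mathbf{r}\in\mathbb{N}_0^r$ and $\mathbf{s}\in\mathbb{N}_0^s$, $\mathcal{A}(\mathbf{r},\mathbf{s})$ is the set of $r\times s$ matrices with entries in $\{0,1\}$ whose row-sum vector is $\mathbf{r}$ and column-sum vector is $\mathbf{s}$. For $k,\ell\in\mathbb{N}$, $\widetilde{\mathcal{D}}(k,\ell)$ is the set of pairs $(\mathbf{m},\mathbf{n})\in\mathbb{N}^k\times\mathbb{N}^\ell$ for which there exist $s\in\mathbb{N}$, $\mathbf{r}\in\mathbb{N}_0^s$, $V\in\mathcal{A}(\mathbf{r},\mathbf{m})$ and $W\in\mathcal{A}(\mathbf{r},\mathbf{n})$ such that every entry of $V^\top W$ is a positive integer. -}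

module Defs where

open import Data.Nat using (ℕ; zero; suc; _+_; _*_; _≤_)
open import Data.Fin using (Fin)
open import Data.Product using (Σ; _×_; ∃)
open import Data.Sum using (_⊎_)
open import Relation.Binary.PropositionalEquality using (_≡_)

∑ : ∀ {n} → (Fin n → ℕ) → ℕ
∑ {zero}  f = 0
∑ {suc n} f = f Fin.zero + ∑ (λ i → f (Fin.suc i))

Mat : ℕ → ℕ → Set
Mat r c = Fin r → Fin c → ℕ

rowSums : ∀ {r c} → Mat r c → Fin r → ℕ
rowSums A i = ∑ (λ j → A i j)

colSums : ∀ {r c} → Mat r c → Fin c → ℕ
colSums A j = ∑ (λ i → A i j)

𝒜 : ∀ {r c} → (Fin r → ℕ) → (Fin c → ℕ) → Mat r c → Set
𝒜 rs cs A =
  (∀ i j → A i j ≡ 0 ⊎ A i j ≡ 1)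
  × (∀ i → rowSums A i ≡ rs i)
  × (∀ j → colSums A j ≡ cs j)

transposeMul : ∀ {s k ℓ} → Mat s k → Mat s ℓ → Mat k ℓ
transposeMul V W a b = ∑ (λ i → V i a * W i b)

Pos : ∀ {n} → (Fin n → ℕ) → Set
Pos x = ∀ i → 1 ≤ x i

D̃ : (k ℓ : ℕ) → (Fin k → ℕ) → (Fin ℓ → ℕ) → Set
D̃ k ℓ m n =
  Pos m × Pos n ×
  Σ ℕ λ s → 1 ≤ s ×
  Σ (Fin s → ℕ) λ r →
  Σ (Mat s k) λ V → Σ (Mat s ℓ) λ W →
    𝒜 r m V × 𝒜 r n W × (∀ a b → 1 ≤ transposeMul V W a b)

{-# OPTIONS --safe #-}
-- Adding a new row whose V-part is the unit vector at column a and whose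
-- W-part is the unit vector at column b keeps V and W 0/1 with equal row sums
-- (both are 1), raises m_a and n_b by one, and can only increase Vᵀ W.  Since
-- |p| = |q|, the increments p and q can be peeled off one unit at a time in
-- pairs, one new row per pair.
module Submission where

open import Defs
open import Data.Nat using (ℕ; zero; suc; _+_; _≤_)
open import Data.Nat.Properties
  using (suc-injective; +-identityʳ; +-comm; +-assoc; m≤m+n; m≤n+m; ≤-trans; m+n≡0⇒m≡0; m+n≡0⇒n≡0)
open import Data.Fin using (Fin)
open import Data.Vec.Functional using (_∷_; tail)
open import Data.Product using (Σ; _×_; _,_)
open import Data.Sum using (_⊎_; inj₁; inj₂)
open import Relation.Binary.PropositionalEquality
  using (_≡_; refl; sym; trans; cong; cong₂; subst)

δ : ∀ {n} → Fin n → Fin n → ℕ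
δ Fin.zero    Fin.zero    = 1
δ Fin.zero    (Fin.suc _) = 0
δ (Fin.suc _) Fin.zero    = 0
δ (Fin.suc a) (Fin.suc i) = δ a i

δ-binary : ∀ {n} (a i : Fin n) → δ a i ≡ 0 ⊎ δ a i ≡ 1
δ-binary Fin.zero    Fin.zero    = inj₂ refl
δ-binary Fin.zero    (Fin.suc _) = inj₁ refl
δ-binary (Fin.suc _) Fin.zero    = inj₁ refl
δ-binary (Fin.suc a) (Fin.suc i) = δ-binary a i

∑-cong : ∀ {n} {f g : Fin n → ℕ} → (∀ i → f i ≡ g i) → ∑ f ≡ ∑ g
∑-cong {zero}  f≗g = refl
∑-cong {suc n} f≗g = cong₂ _+_ (f≗g Fin.zero) (∑-cong (λ i → f≗g (Fin.suc i)))

∑-zero : ∀ n → ∑ {n} (λ _ → 0) ≡ 0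
∑-zero zero    = refl
∑-zero (suc n) = ∑-zero n

∑-δ : ∀ {n} (a : Fin n) → ∑ (δ a) ≡ 1
∑-δ {suc n} Fin.zero    = cong suc (∑-zero n)
∑-δ {suc n} (Fin.suc a) = ∑-δ a

∑≡0⇒≡0 : ∀ {n} (f : Fin n → ℕ) → ∑ f ≡ 0 → ∀ i → f i ≡ 0
∑≡0⇒≡0 f ∑f≡0 Fin.zero    = m+n≡0⇒m≡0 (f Fin.zero) ∑f≡0
∑≡0⇒≡0 f ∑f≡0 (Fin.suc i) = ∑≡0⇒≡0 (tail f) (m+n≡0⇒n≡0 (f Fin.zero) ∑f≡0) i

∑≡suc⇒δ+ : ∀ {n N} (f : Fin n → ℕ) → ∑ f ≡ suc N →
  Σ (Fin n) λ a → Σ (Fin n → ℕ) λ g → (∀ i → f i ≡ δ a i + g i) × ∑ g ≡ N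
∑≡suc⇒δ+ {suc n} f ∑f≡1+N with f Fin.zero in f₀≡
... | suc x = Fin.zero , x ∷ tail f , split , suc-injective ∑f≡1+N
  where
  split : ∀ i → f i ≡ δ Fin.zero i + (x ∷ tail f) i
  split Fin.zero    = f₀≡
  split (Fin.suc i) = refl
... | zero with ∑≡suc⇒δ+ (tail f) ∑f≡1+N
...   | a , g , tail-split , ∑g≡N = Fin.suc a , 0 ∷ g , split , ∑g≡N
  where
  split : ∀ i → f i ≡ δ (Fin.suc a) i + (0 ∷ g) i
  split Fin.zero    = f₀≡
  split (Fin.suc i) = tail-split i

D̃-cong : ∀ {k ℓ} {m m′ : Fin k → ℕ} {n n′ : Fin ℓ → ℕ} →
  (∀ i → m i ≡ m′ i) → (∀ j → n j ≡ n′ j) → D̃ k ℓ m n → D̃ k ℓ m′ n′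
D̃-cong m≗m′ n≗n′ (m⁺ , n⁺ , s , 1≤s , r , V , W , (V01 , Vr , Vc) , (W01 , Wr , Wc) , VᵀW⁺) =
  (λ i → subst (1 ≤_) (m≗m′ i) (m⁺ i)) , (λ j → subst (1 ≤_) (n≗n′ j) (n⁺ j)) ,
  s , 1≤s , r , V , W ,
  (V01 , Vr , λ j → trans (Vc j) (m≗m′ j)) ,
  (W01 , Wr , λ j → trans (Wc j) (n≗n′ j)) , VᵀW⁺

D̃-+δ : ∀ {k ℓ} {m : Fin k → ℕ} {n : Fin ℓ → ℕ} (a : Fin k) (b : Fin ℓ) →
  D̃ k ℓ m n → D̃ k ℓ (λ i → m i + δ a i) (λ j → n j + δ b j)
D̃-+δ {m = m} {n} a b (m⁺ , n⁺ , s , _ , r , V , W , (V01 , Vr , Vc) , (W01 , Wr , Wc) , VᵀW⁺) =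
  (λ i → ≤-trans (m⁺ i) (m≤m+n (m i) _)) , (λ j → ≤-trans (n⁺ j) (m≤m+n (n j) _)) ,
  suc s , m≤m+n 1 s , 1 ∷ r , δ a ∷ V , δ b ∷ W ,
  (V′01 , V′r , λ j → trans (cong (δ a j +_) (Vc j)) (+-comm (δ a j) (m j))) ,
  (W′01 , W′r , λ j → trans (cong (δ b j +_) (Wc j)) (+-comm (δ b j) (n j))) ,
  λ x y → ≤-trans (VᵀW⁺ x y) (m≤n+m _ _)
  where
  V′01 : ∀ i j → (δ a ∷ V) i j ≡ 0 ⊎ (δ a ∷ V) i j ≡ 1
  V′01 Fin.zero    = δ-binary a
  V′01 (Fin.suc i) = V01 i
  W′01 : ∀ i j → (δ b ∷ W) i j ≡ 0 ⊎ (δ b ∷ W) i j ≡ 1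
  W′01 Fin.zero    = δ-binary b
  W′01 (Fin.suc i) = W01 i
  V′r : ∀ i → rowSums (δ a ∷ V) i ≡ (1 ∷ r) i
  V′r Fin.zero    = ∑-δ a
  V′r (Fin.suc i) = Vr i
  W′r : ∀ i → rowSums (δ b ∷ W) i ≡ (1 ∷ r) i
  W′r Fin.zero    = ∑-δ b
  W′r (Fin.suc i) = Wr i

D̃-+-balanced : ∀ {k ℓ} N {m : Fin k → ℕ} {n : Fin ℓ → ℕ} (p : Fin k → ℕ) (q : Fin ℓ → ℕ) →
  ∑ p ≡ N → ∑ q ≡ N → D̃ k ℓ m n → D̃ k ℓ (λ i → m i + p i) (λ j → n j + q j)
D̃-+-balanced zero {m} {n} p q ∑p≡0 ∑q≡0 =
  D̃-cong (λ i → sym (trans (cong (m i +_) (∑≡0⇒≡0 p ∑p≡0 i)) (+-identityʳ (m i))))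
         (λ j → sym (trans (cong (n j +_) (∑≡0⇒≡0 q ∑q≡0 j)) (+-identityʳ (n j))))
D̃-+-balanced (suc N) {m} {n} p q ∑p≡1+N ∑q≡1+N D
  with ∑≡suc⇒δ+ p ∑p≡1+N | ∑≡suc⇒δ+ q ∑q≡1+N
... | a , p′ , p-split , ∑p′≡N | b , q′ , q-split , ∑q′≡N =
  D̃-cong (λ i → trans (+-assoc (m i) (δ a i) (p′ i)) (cong (m i +_) (sym (p-split i))))
         (λ j → trans (+-assoc (n j) (δ b j) (q′ j)) (cong (n j +_) (sym (q-split j))))
         (D̃-+-balanced N p′ q′ ∑p′≡N ∑q′≡N (D̃-+δ a b D))

lemma2p4 : (k ℓ : ℕ) → 1 ≤ k → k ≤ ℓ →
    (m : Fin k → ℕ) (n : Fin ℓ → ℕ) → D̃ k ℓ m n →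
    (p : Fin k → ℕ) (q : Fin ℓ → ℕ) → ∑ p ≡ ∑ q →
    D̃ k ℓ (λ i → m i + p i) (λ j → n j + q j)
lemma2p4 k ℓ _ _ m n D p q ∑p≡∑q = D̃-+-balanced (∑ q) p q ∑p≡∑q refl D
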